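{- Let $D=(X,\mathcal{B})$ be a finite affine plane of order $q$, i.e. a $2$-$(q^2,q,1)$ design. Then $\gamma(D)=2q-1$.
   Context: A $2$-$(v,k,\lambda)$ design $D=(X,\mathcal{B})$ consists of a set $X$ of $v$ points and a family $\mathcal{B}$ of $k$-subsets (blocks) such that every pair of distinct points lies in exactly $\lambda$ blocks (with $v\geq k\geq 2$). The incidence graph $G_D$ has vertex set $X\cup\mathcal{B}$ with $x$ adjacent to $B$ iff $x\in B$. A dominating set is a set $S$ of vertices such that every vertex not in $S$ is adjacent to some vertex of $S$; $\gamma(D)$ is the minimum size of a dominating set of $G_D$. -}

module Defs where

open import Data.Nat using (ℕ; _≤_; _*_)
open import Data.Fin using (Fin)
open import Data.Fin.Subset using (Subset; _∈_; _∉_; ∣_∣)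
open import Data.Fin.Subset.Properties using (_∈?_)
open import Data.Bool using (Bool; _∧_)
open import Data.Vec using (tabulate)
open import Data.Sum using (_⊎_; inj₁; inj₂)
open import Data.Product using (Σ; ∃; ∃-syntax; _×_; _,_)
open import Relation.Nullary using (¬_)
open import Relation.Nullary.Decidable using (⌊_⌋)
open import Relation.Binary.PropositionalEquality using (_≡_)

pairCount : ∀ {v b} → (Fin b → Subset v) → Fin v → Fin v → ℕ
pairCount {v} {b} B x y = ∣ tabulate (λ i → ⌊ x ∈? B i ⌋ ∧ ⌊ y ∈? B i ⌋) ∣

-- A 2-(v,k,λ) design on point set Fin v, with a family of b blocks
-- (indexed by Fin b, so repeated blocks are allowed).
record Design (v k lam : ℕ) : Set where
  field
    b       : ℕ
    block   : Fin b → Subset v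
    k≥2     : 2 ≤ k
    k≤v     : k ≤ v
    blockSize : ∀ i → ∣ block i ∣ ≡ k
    balanced  : ∀ x y → ¬ x ≡ y → pairCount block x y ≡ lam

open Design public

-- Vertices of the incidence graph G_D: points ⊎ blocks.
Vertex : ∀ {v k lam} → Design v k lam → Set
Vertex {v} D = Fin v ⊎ Fin (b D)

Adj : ∀ {v k lam} (D : Design v k lam) → Vertex D → Vertex D → Set
Adj D (inj₁ x) (inj₁ y) = Data.Empty.⊥
  where import Data.Empty
Adj D (inj₁ x) (inj₂ B) = x ∈ block D B
Adj D (inj₂ B) (inj₁ x) = x ∈ block D B
Adj D (inj₂ B) (inj₂ C) = Data.Empty.⊥
  where import Data.Empty

VSet : ∀ {v k lam} → Design v k lam → Set
VSet {v} D = Subset v × Subset (b D)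

_∈V_ : ∀ {v k lam} {D : Design v k lam} → Vertex D → VSet D → Set
inj₁ x ∈V (SX , SB) = x ∈ SX
inj₂ B ∈V (SX , SB) = B ∈ SB

size : ∀ {v k lam} {D : Design v k lam} → VSet D → ℕ
size (SX , SB) = ∣ SX ∣ Data.Nat.+ ∣ SB ∣
  where import Data.Nat

Dominating : ∀ {v k lam} (D : Design v k lam) → VSet D → Set
Dominating D S = ∀ (u : Vertex D) → ¬ (_∈V_ {D = D} u S) →
  ∃[ w ] (_∈V_ {D = D} w S × Adj D u w)

DominationNumber : ∀ {v k lam} → Design v k lam → ℕ → Set
DominationNumber D n =
  (∃[ S ] (Dominating D S × size {D = D} S ≡ n)) ×
  (∀ S → Dominating D S → n ≤ size {D = D} S)

-- In an affine plane of order q every point lies on q + 1 blocks, there are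
-- q (q + 1) blocks, and through a point off a block o there is exactly one
-- block disjoint from o (Playfair).  Hence o together with its q - 1 parallels
-- is a dominating set of size 2q - 1.  Conversely, if P and L are the point and
-- block parts of a dominating set, counting the points covered gives
-- q² ≤ |P| + q |L|, and counting the blocks covered gives
-- q (q + 1) ≤ |L| + (q + 1) |P|; for integers these force |P| + |L| ≥ 2q - 1.
module Submission where

open import Defs
open import Data.Nat using (ℕ; _*_; _+_; _∸_)

open import Data.Nat.Base using (zero; suc; _≤_; _<_; z≤n; s≤s; _≡ᵇ_)
open import Data.Nat.Properties
open import Data.Nat.Tactic.RingSolver using (solve-∀)
open import Data.Fin.Base using (Fin; zero; suc; punchOut; fromℕ<)
open import Data.Fin.Properties using (punchIn-punchOut; punchInᵢ≢i)
  renaming (_≟_ to _≟ᶠ_; suc-injective to suc-injectiveᶠ; 0≢1+n to 0≢1+nᶠ)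
open import Data.Fin.Subset using (Subset; inside; outside; _∈_; _∉_; ∣_∣)
open import Data.Fin.Subset.Properties using (_∈?_)
open import Data.Vec.Base using (_∷_; []; tabulate; lookup)
open import Data.Vec.Properties using ([]=⇒lookup; lookup⇒[]=; lookup∘tabulate)
open import Data.Vec.Functional using (removeAt)
open import Data.Bool.Base using (Bool; true; false; _∧_)
open import Data.Sum.Base using (inj₁; inj₂)
open import Data.Product.Base using (∃-syntax; _×_; _,_)
open import Function.Base using (_∘_)
open import Relation.Nullary using (yes; no; contradiction)
open import Relation.Nullary.Decidable using (⌊_⌋)
open import Relation.Binary.PropositionalEquality
open import Algebra.Properties.CommutativeMonoid.Sum +-0-commutativeMonoid
  using (sum; sum-syntax; sum-cong-≗; sum-remove; sum-replicate-zero; ∑-comm; ∑-distrib-+)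
open import Algebra.Properties.Semiring.Sum +-*-semiring
  using (*-distribˡ-sum; *-distribʳ-sum)

∑-const : ∀ n c → ∑[ i < n ] c ≡ n * c
∑-const zero    c = refl
∑-const (suc n) c = cong (c +_) (∑-const n c)

∑-mono-≤ : ∀ {n} {f g : Fin n → ℕ} → (∀ i → f i ≤ g i) → sum f ≤ sum g
∑-mono-≤ {zero}  f≤g = z≤n
∑-mono-≤ {suc n} f≤g = +-mono-≤ (f≤g zero) (∑-mono-≤ (f≤g ∘ suc))

term≤∑ : ∀ {n} (f : Fin n → ℕ) i → f i ≤ sum f
term≤∑ {suc n} f i = subst (f i ≤_) (sym (sum-remove {i = i} f)) (m≤m+n (f i) _)

two-terms≤∑ : ∀ {n} (f : Fin n → ℕ) {i j} → i ≢ j → f i + f j ≤ sum f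
two-terms≤∑ {suc n} f {i} {j} i≢j = begin
  f i + f j                          ≡⟨ cong (λ z → f i + f z) (punchIn-punchOut i≢j) ⟨
  f i + removeAt f i (punchOut i≢j)  ≤⟨ +-monoʳ-≤ (f i) (term≤∑ (removeAt f i) (punchOut i≢j)) ⟩
  f i + sum (removeAt f i)           ≡⟨ sum-remove f ⟨
  sum f                              ∎
  where open ≤-Reasoning

∑-pos⇒∃ : ∀ {n} (f : Fin n → ℕ) → 0 < sum f → ∃[ i ] 0 < f i
∑-pos⇒∃ {suc n} f pos with f zero in eq
... | suc _ = zero , subst (0 <_) (sym eq) (s≤s z≤n)
... | zero  with i , fi>0 ← ∑-pos⇒∃ (f ∘ suc) pos = suc i , fi>0

∑-at-most-one : ∀ {n} (f : Fin n → ℕ) → (∀ i → f i ≤ 1) →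
                (∀ i j → 0 < f i → 0 < f j → i ≡ j) → sum f ≤ 1
∑-at-most-one {zero}  f f≤1 unique = z≤n
∑-at-most-one {suc n} f f≤1 unique with f zero in eq
... | zero  = ∑-at-most-one (f ∘ suc) (f≤1 ∘ suc)
                (λ i j fi>0 fj>0 → suc-injectiveᶠ (unique _ _ fi>0 fj>0))
... | suc m = begin
  suc m + sum (f ∘ suc)  ≡⟨ cong (suc m +_) (trans (sum-cong-≗ rest≡0) (sum-replicate-zero n)) ⟩
  suc m + 0              ≡⟨ trans (+-identityʳ (suc m)) (sym eq) ⟩
  f zero                 ≤⟨ f≤1 zero ⟩
  1                      ∎
  where
  open ≤-Reasoning
  rest≡0 : ∀ i → f (suc i) ≡ 0
  rest≡0 i = n≤0⇒n≡0 (≮⇒≥ λ fi>0 → 0≢1+nᶠ (unique zero (suc i) (subst (0 <_) (sym eq) (s≤s z≤n)) fi>0))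

∑-all-but-one : ∀ {n} (f : Fin n → ℕ) {c} x → (∀ z → z ≢ x → f z ≡ c) →
                sum f + c ≡ f x + n * c
∑-all-but-one {suc n} f {c} x others = begin
  sum f + c                     ≡⟨ cong (_+ c) (sum-remove {i = x} f) ⟩
  f x + sum (removeAt f x) + c  ≡⟨ cong (λ t → f x + t + c) rest ⟩
  f x + n * c + c               ≡⟨ +-assoc (f x) (n * c) c ⟩
  f x + (n * c + c)             ≡⟨ cong (f x +_) (+-comm (n * c) c) ⟩
  f x + suc n * c               ∎
  where
  open ≡-Reasoning
  rest : sum (removeAt f x) ≡ n * c
  rest = trans (sum-cong-≗ (λ j → others _ (punchInᵢ≢i x j))) (∑-const n c)

*-pos⇒pos : ∀ m n → 0 < m * n → 0 < m × 0 < n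
*-pos⇒pos (suc m) (suc n) _     = s≤s z≤n , s≤s z≤n
*-pos⇒pos (suc m) zero    m*0>0 = contradiction (subst (0 <_) (*-zeroʳ m) m*0>0) (<-irrefl refl)

𝟙 : Bool → ℕ
𝟙 true  = 1
𝟙 false = 0

𝟙-∧ : ∀ a b → 𝟙 (a ∧ b) ≡ 𝟙 a * 𝟙 b
𝟙-∧ true  b = sym (+-identityʳ (𝟙 b))
𝟙-∧ false b = refl

𝟙-idem : ∀ a → 𝟙 a * 𝟙 a ≡ 𝟙 a
𝟙-idem true  = refl
𝟙-idem false = refl

𝟙[≡ᵇ0]+n-pos : ∀ n → 0 < 𝟙 (n ≡ᵇ 0) + n
𝟙[≡ᵇ0]+n-pos zero    = s≤s z≤n
𝟙[≡ᵇ0]+n-pos (suc n) = s≤s z≤n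

𝟙[≡ᵇ0]-pos : ∀ {n} → 0 < n → 𝟙 (n ≡ᵇ 0) ≡ 0
𝟙[≡ᵇ0]-pos {suc n} _ = refl

𝟙[≡ᵇ0]-complement : ∀ {n} → n ≤ 1 → n + 𝟙 (n ≡ᵇ 0) ≡ 1
𝟙[≡ᵇ0]-complement {zero}        _        = refl
𝟙[≡ᵇ0]-complement {suc zero}    _        = refl
𝟙[≡ᵇ0]-complement {suc (suc _)} (s≤s ())

-- Defined through lookup rather than ⌊ x ∈? p ⌋ so that it computes by
-- structural recursion on p.
χ : ∀ {n} → Subset n → Fin n → ℕ
χ p x = 𝟙 (lookup p x)

χ-∈ : ∀ {n} {p : Subset n} {x} → x ∈ p → χ p x ≡ 1
χ-∈ x∈p = cong 𝟙 ([]=⇒lookup x∈p)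

χ-∉ : ∀ {n} {p : Subset n} {x} → x ∉ p → χ p x ≡ 0
χ-∉ {p = p} {x} x∉p with lookup p x in eq
... | true  = contradiction (lookup⇒[]= x p eq) x∉p
... | false = refl

χ≤1 : ∀ {n} (p : Subset n) x → χ p x ≤ 1
χ≤1 p x with lookup p x
... | true  = s≤s z≤n
... | false = z≤n

χ-pos⇒∈ : ∀ {n} (p : Subset n) {x} → 0 < χ p x → x ∈ p
χ-pos⇒∈ p {x} χ>0 with lookup p x in eq
... | true = lookup⇒[]= x p eq

χ*χ-pos⇒∈ : ∀ {m n} (p : Subset m) (p′ : Subset n) {x y} →
            0 < χ p x * χ p′ y → x ∈ p × y ∈ p′
χ*χ-pos⇒∈ p p′ pos with χx>0 , χy>0 ← *-pos⇒pos _ _ pos = χ-pos⇒∈ p χx>0 , χ-pos⇒∈ p′ χy>0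

χ*χ-∈ : ∀ {m n} {p : Subset m} {p′ : Subset n} {x y} →
        x ∈ p → y ∈ p′ → χ p x * χ p′ y ≡ 1
χ*χ-∈ x∈p y∈p′ = cong₂ _*_ (χ-∈ x∈p) (χ-∈ y∈p′)

χ-tabulate : ∀ {n} (g : Fin n → Bool) i → χ (tabulate g) i ≡ 𝟙 (g i)
χ-tabulate g i = cong 𝟙 (lookup∘tabulate g i)

∣p∣≡∑χ : ∀ {n} (p : Subset n) → ∣ p ∣ ≡ ∑[ x < n ] χ p x
∣p∣≡∑χ []            = refl
∣p∣≡∑χ (inside  ∷ p) = cong suc (∣p∣≡∑χ p)
∣p∣≡∑χ (outside ∷ p) = ∣p∣≡∑χ p

⌊∈?⌋≡lookup : ∀ {n} (p : Subset n) x → ⌊ x ∈? p ⌋ ≡ lookup p x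
⌊∈?⌋≡lookup p x with x ∈? p
... | yes x∈p = sym ([]=⇒lookup x∈p)
... | no  x∉p with lookup p x in eq
...   | true  = contradiction (lookup⇒[]= x p eq) x∉p
...   | false = refl

module Incidence {v k lam} (D : Design v k lam) where

  inc : Fin (b D) → Fin v → ℕ
  inc i = χ (block D i)

  replication : Fin v → ℕ
  replication x = ∑[ i < b D ] inc i x

  ∑-inc≡k : ∀ i → ∑[ x < v ] inc i x ≡ k
  ∑-inc≡k i = trans (sym (∣p∣≡∑χ (block D i))) (blockSize D i)

  pairCount≡∑ : ∀ x y → pairCount (block D) x y ≡ ∑[ i < b D ] (inc i x * inc i y)
  pairCount≡∑ x y = trans (∣p∣≡∑χ (tabulate both)) (sum-cong-≗ λ i → begin
    χ (tabulate both) i                          ≡⟨ χ-tabulate both i ⟩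
    𝟙 (⌊ x ∈? block D i ⌋ ∧ ⌊ y ∈? block D i ⌋)  ≡⟨ 𝟙-∧ ⌊ x ∈? block D i ⌋ ⌊ y ∈? block D i ⌋ ⟩
    𝟙 ⌊ x ∈? block D i ⌋ * 𝟙 ⌊ y ∈? block D i ⌋  ≡⟨ cong₂ (λ a c → 𝟙 a * 𝟙 c) (⌊∈?⌋≡lookup _ x) (⌊∈?⌋≡lookup _ y) ⟩
    inc i x * inc i y                            ∎)
    where
    open ≡-Reasoning
    both : Fin (b D) → Bool
    both i = ⌊ x ∈? block D i ⌋ ∧ ⌊ y ∈? block D i ⌋

  ∑-weighted-blocks : (f : Fin (b D) → ℕ) →
                      ∑[ x < v ] ∑[ i < b D ] (f i * inc i x) ≡ sum f * k
  ∑-weighted-blocks f = begin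
    ∑[ x < v ] ∑[ i < b D ] (f i * inc i x)  ≡⟨ ∑-comm (λ x i → f i * inc i x) ⟩
    ∑[ i < b D ] ∑[ x < v ] (f i * inc i x)  ≡⟨ sum-cong-≗ (λ i → *-distribˡ-sum (f i) (inc i)) ⟨
    ∑[ i < b D ] (f i * ∑[ x < v ] inc i x)  ≡⟨ sum-cong-≗ (λ i → cong (f i *_) (∑-inc≡k i)) ⟩
    ∑[ i < b D ] (f i * k)                   ≡⟨ *-distribʳ-sum k f ⟨
    sum f * k                                ∎
    where open ≡-Reasoning

  ∑-weighted-points : (g : Fin v → ℕ) →
                      ∑[ i < b D ] ∑[ x < v ] (g x * inc i x) ≡ ∑[ x < v ] (g x * replication x)
  ∑-weighted-points g = begin
    ∑[ i < b D ] ∑[ x < v ] (g x * inc i x)  ≡⟨ ∑-comm (λ i x → g x * inc i x) ⟩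
    ∑[ x < v ] ∑[ i < b D ] (g x * inc i x)  ≡⟨ sum-cong-≗ (λ x → *-distribˡ-sum (g x) (λ i → inc i x)) ⟨
    ∑[ x < v ] (g x * replication x)         ∎
    where open ≡-Reasoning

  b*k≡∑replication : b D * k ≡ ∑[ x < v ] replication x
  b*k≡∑replication = begin
    b D * k                                ≡⟨ cong (_* k) (trans (∑-const (b D) 1) (*-identityʳ (b D))) ⟨
    (∑[ i < b D ] 1) * k                   ≡⟨ ∑-weighted-blocks (λ _ → 1) ⟨
    ∑[ x < v ] ∑[ i < b D ] (1 * inc i x)  ≡⟨ sum-cong-≗ (λ x → sum-cong-≗ (λ i → *-identityˡ (inc i x))) ⟩
    ∑[ x < v ] replication x               ∎
    where open ≡-Reasoning

  ∑-through-point : ∀ x (g : Fin v → ℕ) →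
    ∑[ i < b D ] (inc i x * ∑[ z < v ] (g z * inc i z)) ≡ ∑[ z < v ] (pairCount (block D) x z * g z)
  ∑-through-point x g = begin
    ∑[ i < b D ] (inc i x * ∑[ z < v ] (g z * inc i z))  ≡⟨ sum-cong-≗ (λ i → *-distribˡ-sum (inc i x) (λ z → g z * inc i z)) ⟩
    ∑[ i < b D ] ∑[ z < v ] (inc i x * (g z * inc i z))  ≡⟨ ∑-comm (λ i z → inc i x * (g z * inc i z)) ⟩
    ∑[ z < v ] ∑[ i < b D ] (inc i x * (g z * inc i z))  ≡⟨ sum-cong-≗ (λ z → sum-cong-≗ (λ i → regroup (inc i x) (g z) (inc i z))) ⟩
    ∑[ z < v ] ∑[ i < b D ] (inc i x * inc i z * g z)    ≡⟨ sum-cong-≗ (λ z → *-distribʳ-sum (g z) (λ i → inc i x * inc i z)) ⟨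
    ∑[ z < v ] (∑[ i < b D ] (inc i x * inc i z) * g z)  ≡⟨ sum-cong-≗ (λ z → cong (_* g z) (pairCount≡∑ x z)) ⟨
    ∑[ z < v ] (pairCount (block D) x z * g z)           ∎
    where
    open ≡-Reasoning
    regroup : ∀ a c d → a * (c * d) ≡ a * d * c
    regroup = solve-∀

  pairCount-diagonal : ∀ x → pairCount (block D) x x ≡ replication x
  pairCount-diagonal x = trans (pairCount≡∑ x x) (sum-cong-≗ λ i → 𝟙-idem (lookup (block D i) x))

  replication-identity : ∀ x → replication x * k + lam ≡ replication x + lam * v
  replication-identity x = begin
    replication x * k + lam                         ≡⟨ cong (_+ lam) ∑pairCount≡r*k ⟨
    ∑[ z < v ] (pairCount (block D) x z * 1) + lam  ≡⟨ ∑-all-but-one _ x others ⟩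
    pairCount (block D) x x * 1 + v * lam           ≡⟨ cong₂ _+_ (trans (*-identityʳ _) (pairCount-diagonal x)) (*-comm v lam) ⟩
    replication x + lam * v                         ∎
    where
    open ≡-Reasoning
    others : ∀ z → z ≢ x → pairCount (block D) x z * 1 ≡ lam
    others z z≢x = trans (*-identityʳ _) (balanced D x z (z≢x ∘ sym))
    ∑pairCount≡r*k : ∑[ z < v ] (pairCount (block D) x z * 1) ≡ replication x * k
    ∑pairCount≡r*k = begin
      ∑[ z < v ] (pairCount (block D) x z * 1)           ≡⟨ ∑-through-point x (λ _ → 1) ⟨
      ∑[ i < b D ] (inc i x * ∑[ z < v ] (1 * inc i z))  ≡⟨ sum-cong-≗ (λ i → cong (inc i x *_) (trans (sum-cong-≗ (λ z → *-identityˡ (inc i z))) (∑-inc≡k i))) ⟩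
      ∑[ i < b D ] (inc i x * k)                         ≡⟨ *-distribʳ-sum k (λ i → inc i x) ⟨
      replication x * k                                  ∎

  pointCover : Subset v → Subset (b D) → Fin v → ℕ
  pointCover P L x = χ P x + ∑[ i < b D ] (χ L i * inc i x)

  blockCover : Subset v → Subset (b D) → Fin (b D) → ℕ
  blockCover P L i = χ L i + ∑[ x < v ] (χ P x * inc i x)

  module _ {P : Subset v} {L : Subset (b D)} where

    dominating⇒pointCover : Dominating D (P , L) → ∀ x → 0 < pointCover P L x
    dominating⇒pointCover dom x with x ∈? P
    ... | yes x∈P = ≤-trans (≤-reflexive (sym (χ-∈ x∈P))) (m≤m+n _ _)
    ... | no  x∉P with dom (inj₁ x) x∉P
    ...   | inj₂ i , i∈L , x∈i = begin
      1                               ≡⟨ χ*χ-∈ i∈L x∈i ⟨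
      χ L i * inc i x                 ≤⟨ term≤∑ (λ j → χ L j * inc j x) i ⟩
      ∑[ j < b D ] (χ L j * inc j x)  ≤⟨ m≤n+m _ (χ P x) ⟩
      pointCover P L x                ∎
      where open ≤-Reasoning

    dominating⇒blockCover : Dominating D (P , L) → ∀ i → 0 < blockCover P L i
    dominating⇒blockCover dom i with i ∈? L
    ... | yes i∈L = ≤-trans (≤-reflexive (sym (χ-∈ i∈L))) (m≤m+n _ _)
    ... | no  i∉L with dom (inj₂ i) i∉L
    ...   | inj₁ x , x∈P , x∈i = begin
      1                             ≡⟨ χ*χ-∈ x∈P x∈i ⟨
      χ P x * inc i x               ≤⟨ term≤∑ (λ y → χ P y * inc i y) x ⟩
      ∑[ y < v ] (χ P y * inc i y)  ≤⟨ m≤n+m _ (χ L i) ⟩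
      blockCover P L i              ∎
      where open ≤-Reasoning

    covered⇒dominating : (∀ x → 0 < pointCover P L x) → (∀ i → 0 < blockCover P L i) →
                         Dominating D (P , L)
    covered⇒dominating points blocks (inj₁ x) x∉P
      with i , pos ← ∑-pos⇒∃ (λ j → χ L j * inc j x) (subst (λ c → 0 < c + _) (χ-∉ x∉P) (points x))
      with i∈L , x∈i ← χ*χ-pos⇒∈ L (block D i) pos = inj₂ i , i∈L , x∈i
    covered⇒dominating points blocks (inj₂ i) i∉L
      with x , pos ← ∑-pos⇒∃ (λ y → χ P y * inc i y) (subst (λ c → 0 < c + _) (χ-∉ i∉L) (blocks i))
      with x∈P , x∈i ← χ*χ-pos⇒∈ P (block D i) pos = inj₁ x , x∈P , x∈i

    dominating⇒points≤ : Dominating D (P , L) → v ≤ ∣ P ∣ + ∣ L ∣ * k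
    dominating⇒points≤ dom = begin
      v                                                      ≡⟨ trans (∑-const v 1) (*-identityʳ v) ⟨
      ∑[ x < v ] 1                                           ≤⟨ ∑-mono-≤ (dominating⇒pointCover dom) ⟩
      ∑[ x < v ] pointCover P L x                            ≡⟨ ∑-distrib-+ (χ P) _ ⟩
      sum (χ P) + ∑[ x < v ] ∑[ i < b D ] (χ L i * inc i x)  ≡⟨ cong₂ _+_ (sym (∣p∣≡∑χ P)) (∑-weighted-blocks (χ L)) ⟩
      ∣ P ∣ + sum (χ L) * k                                  ≡⟨ cong (λ c → ∣ P ∣ + c * k) (∣p∣≡∑χ L) ⟨
      ∣ P ∣ + ∣ L ∣ * k                                      ∎
      where open ≤-Reasoning

    dominating⇒blocks≤ : Dominating D (P , L) → ∀ {r} → (∀ x → replication x ≡ r) →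
                         b D ≤ ∣ L ∣ + ∣ P ∣ * r
    dominating⇒blocks≤ dom {r} replication≡r = begin
      b D                                                    ≡⟨ trans (∑-const (b D) 1) (*-identityʳ (b D)) ⟨
      ∑[ i < b D ] 1                                         ≤⟨ ∑-mono-≤ (dominating⇒blockCover dom) ⟩
      ∑[ i < b D ] blockCover P L i                          ≡⟨ ∑-distrib-+ (χ L) _ ⟩
      sum (χ L) + ∑[ i < b D ] ∑[ x < v ] (χ P x * inc i x)  ≡⟨ cong₂ _+_ (sym (∣p∣≡∑χ L)) (∑-weighted-points (χ P)) ⟩
      ∣ L ∣ + ∑[ x < v ] (χ P x * replication x)             ≡⟨ cong (∣ L ∣ +_) (sum-cong-≗ (λ x → cong (χ P x *_) (replication≡r x))) ⟩
      ∣ L ∣ + ∑[ x < v ] (χ P x * r)                         ≡⟨ cong (∣ L ∣ +_) (*-distribʳ-sum r (χ P)) ⟨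
      ∣ L ∣ + sum (χ P) * r                                  ≡⟨ cong (λ c → ∣ L ∣ + c * r) (∣p∣≡∑χ P) ⟨
      ∣ L ∣ + ∣ P ∣ * r                                      ∎
      where open ≤-Reasoning

module LinearSpace {v k} (D : Design v k 1) where
  open Incidence D

  meetCount : Fin (b D) → Fin (b D) → ℕ
  meetCount i j = ∑[ z < v ] (inc i z * inc j z)

  distinct-blocks-meet-at-most-once : ∀ {i j} → i ≢ j → meetCount i j ≤ 1
  distinct-blocks-meet-at-most-once {i} {j} i≢j =
    ∑-at-most-one (λ z → inc i z * inc j z) (λ z → *-mono-≤ (χ≤1 (block D i) z) (χ≤1 (block D j) z))
      common-point-unique
    where
    common-point-unique : ∀ z z′ → 0 < inc i z * inc j z → 0 < inc i z′ * inc j z′ → z ≡ z′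
    common-point-unique z z′ pos pos′ with z ≟ᶠ z′
    ... | yes z≡z′ = z≡z′
    ... | no  z≢z′
      with z∈i , z∈j ← χ*χ-pos⇒∈ (block D i) (block D j) pos
         | z′∈i , z′∈j ← χ*χ-pos⇒∈ (block D i) (block D j) pos′ =
      contradiction two≤one (<-irrefl refl)
      where
      open ≤-Reasoning
      two≤one : 2 ≤ 1
      two≤one = begin
        2                                        ≡⟨ cong₂ _+_ (χ*χ-∈ z∈i z′∈i) (χ*χ-∈ z∈j z′∈j) ⟨
        inc i z * inc i z′ + inc j z * inc j z′  ≤⟨ two-terms≤∑ (λ l → inc l z * inc l z′) i≢j ⟩
        ∑[ l < b D ] (inc l z * inc l z′)        ≡⟨ pairCount≡∑ z z′ ⟨
        pairCount (block D) z z′                 ≡⟨ balanced D z z′ z≢z′ ⟩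
        1                                        ∎

  parallels : Fin (b D) → Subset (b D)
  parallels o = tabulate (λ i → meetCount o i ≡ᵇ 0)

  parallelsThrough : Fin v → Fin (b D) → ℕ
  parallelsThrough x o = ∑[ i < b D ] (χ (parallels o) i * inc i x)

  parallelsThrough-on-block : ∀ {x o} → x ∈ block D o → parallelsThrough x o ≡ 0
  parallelsThrough-on-block {x} {o} x∈o =
    trans (sum-cong-≗ not-parallel) (sum-replicate-zero (b D))
    where
    not-parallel : ∀ i → χ (parallels o) i * inc i x ≡ 0
    not-parallel i with x ∈? block D i
    ... | no  x∉i = trans (cong (χ (parallels o) i *_) (χ-∉ x∉i)) (*-zeroʳ (χ (parallels o) i))
    ... | yes x∈i = cong (_* inc i x) (trans (χ-tabulate (λ j → meetCount o j ≡ᵇ 0) i) (𝟙[≡ᵇ0]-pos meet))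
      where
      meet : 0 < meetCount o i
      meet = ≤-trans (≤-reflexive (sym (χ*χ-∈ x∈o x∈i))) (term≤∑ (λ z → inc o z * inc i z) x)

  replication-off-block : ∀ {x o} → x ∉ block D o → replication x ≡ k + parallelsThrough x o
  replication-off-block {x} {o} x∉o = begin
    replication x                                                  ≡⟨ sum-cong-≗ split ⟩
    ∑[ i < b D ] (inc i x * meetCount o i + χ (parallels o) i * inc i x)
                                                                   ≡⟨ ∑-distrib-+ (λ i → inc i x * meetCount o i) _ ⟩
    ∑[ i < b D ] (inc i x * meetCount o i) + parallelsThrough x o  ≡⟨ cong (_+ parallelsThrough x o) blocks-meeting-o ⟩
    k + parallelsThrough x o                                       ∎
    where
    open ≡-Reasoning
    -- A block through x is not o, so it meets o either once or not at all.
    split : ∀ i → inc i x ≡ inc i x * meetCount o i + χ (parallels o) i * inc i x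
    split i with x ∈? block D i
    ... | no  x∉i = trans (χ-∉ x∉i)
      (sym (trans (cong (λ a → a * meetCount o i + χ (parallels o) i * a) (χ-∉ x∉i))
                  (*-zeroʳ (χ (parallels o) i))))
    ... | yes x∈i = begin
      inc i x                                                ≡⟨ χ-∈ x∈i ⟩
      1                                                      ≡⟨ 𝟙[≡ᵇ0]-complement (distinct-blocks-meet-at-most-once o≢i) ⟨
      meetCount o i + 𝟙 (meetCount o i ≡ᵇ 0)                 ≡⟨ cong₂ _+_ through-x parallel-indicator ⟨
      inc i x * meetCount o i + χ (parallels o) i * inc i x  ∎
      where
      through-x : inc i x * meetCount o i ≡ meetCount o i
      through-x = trans (cong (_* meetCount o i) (χ-∈ x∈i)) (*-identityˡ _)
      parallel-indicator : χ (parallels o) i * inc i x ≡ 𝟙 (meetCount o i ≡ᵇ 0)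
      parallel-indicator =
        trans (cong₂ _*_ (χ-tabulate (λ j → meetCount o j ≡ᵇ 0) i) (χ-∈ x∈i)) (*-identityʳ _)
      o≢i : o ≢ i
      o≢i refl = x∉o x∈i
    blocks-meeting-o : ∑[ i < b D ] (inc i x * meetCount o i) ≡ k
    blocks-meeting-o = begin
      ∑[ i < b D ] (inc i x * meetCount o i)          ≡⟨ ∑-through-point x (inc o) ⟩
      ∑[ z < v ] (pairCount (block D) x z * inc o z)  ≡⟨ sum-cong-≗ only-o ⟩
      ∑[ z < v ] inc o z                              ≡⟨ ∑-inc≡k o ⟩
      k                                               ∎
      where
      only-o : ∀ z → pairCount (block D) x z * inc o z ≡ inc o z
      only-o z with z ≟ᶠ x
      ... | yes refl = trans (cong (pairCount (block D) x x *_) (χ-∉ x∉o))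
                             (trans (*-zeroʳ (pairCount (block D) x x)) (sym (χ-∉ x∉o)))
      ... | no  z≢x  = trans (cong (_* inc o z) (balanced D x z (z≢x ∘ sym))) (*-identityˡ _)

affine-replication : ∀ {q r} → 2 ≤ q → r * q + 1 ≡ r + q * q → r ≡ suc q
affine-replication {suc (suc p)} {r} (s≤s (s≤s _)) identity =
  *-cancelʳ-≡ r (3 + p) (suc p) (+-cancelˡ-≡ (r + 1) _ _ (begin
    r + 1 + r * suc p        ≡⟨ expand r p ⟩
    r * (2 + p) + 1          ≡⟨ identity ⟩
    r + (2 + p) * (2 + p)    ≡⟨ factor r p ⟩
    r + 1 + (3 + p) * suc p  ∎))
  where
  open ≡-Reasoning
  expand : ∀ r p → r + 1 + r * suc p ≡ r * (2 + p) + 1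
  expand = solve-∀
  factor : ∀ r p → r + (2 + p) * (2 + p) ≡ r + 1 + (3 + p) * suc p
  factor = solve-∀

affine-blocks : ∀ {q b} → 1 ≤ q → b * q ≡ q * q * suc q → b ≡ q * suc q
affine-blocks {suc p} {b} (s≤s _) flags = *-cancelʳ-≡ b _ (suc p) (trans flags (reorder (suc p)))
  where
  reorder : ∀ q → q * q * suc q ≡ q * suc q * q
  reorder = solve-∀

affine-parallels : ∀ {q ℓ} → 1 ≤ q → q + ℓ * q ≡ q * q → suc ℓ ≡ q
affine-parallels {suc p} {ℓ} (s≤s _) = *-cancelʳ-≡ (suc ℓ) (suc p) (suc p)

2*suc∸1 : ∀ n → 2 * suc n ∸ 1 ≡ suc (n + n)
2*suc∸1 n = trans (cong (n +_) (*-identityˡ (suc n))) (+-suc n n)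

few-blocks-miss-points : ∀ {p a c} → c ≤ p → a + c ≤ p + p → a + c * suc p < suc p * suc p
few-blocks-miss-points {p} {a} {c} c≤p a+c≤2p = begin-strict
  a + c * suc p        ≡⟨ regroup a c p ⟩
  a + c + c * p        ≤⟨ +-mono-≤ a+c≤2p (*-monoˡ-≤ p c≤p) ⟩
  p + p + p * p        <⟨ n<1+n _ ⟩
  suc (p + p + p * p)  ≡⟨ square p ⟩
  suc p * suc p        ∎
  where
  open ≤-Reasoning
  regroup : ∀ a c p → a + c * suc p ≡ a + c + c * p
  regroup = solve-∀
  square : ∀ p → suc (p + p + p * p) ≡ suc p * suc p
  square = solve-∀

few-points-miss-blocks : ∀ {p a c} → p < c → a + c ≤ p + p → c + a * (2 + p) < suc p * (2 + p)
few-points-miss-blocks {p} {a} {c} p<c a+c≤2p = begin-strict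
  c + a * (2 + p)          ≡⟨ regroup a c p ⟩
  a + c + a * suc p        ≤⟨ +-mono-≤ a+c≤2p (*-monoˡ-≤ (suc p) a≤p) ⟩
  p + p + p * suc p        <⟨ n<1+n _ ⟩
  suc (p + p + p * suc p)  ≤⟨ n≤1+n _ ⟩
  2 + (p + p + p * suc p)  ≡⟨ product p ⟩
  suc p * (2 + p)          ∎
  where
  open ≤-Reasoning
  a≤p : a ≤ p
  a≤p = +-cancelʳ-≤ p a p (≤-trans (+-monoʳ-≤ a (<⇒≤ p<c)) a+c≤2p)
  regroup : ∀ a c p → c + a * (2 + p) ≡ a + c + a * suc p
  regroup = solve-∀
  product : ∀ p → 2 + (p + p + p * suc p) ≡ suc p * (2 + p)
  product = solve-∀

dominating-size-bound : ∀ {q a c} → 1 ≤ q → q * q ≤ a + c * q → q * suc q ≤ c + a * suc q →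
                        2 * q ∸ 1 ≤ a + c
dominating-size-bound {suc p} {a} {c} _ points blocks with a + c ≤? p + p
... | no  a+c≰2p = subst (_≤ a + c) (sym (2*suc∸1 p)) (≰⇒> a+c≰2p)
... | yes a+c≤2p with c ≤? p
...   | yes c≤p = contradiction points (<⇒≱ (few-blocks-miss-points c≤p a+c≤2p))
...   | no  c≰p = contradiction blocks (<⇒≱ (few-points-miss-blocks (≰⇒> c≰p) a+c≤2p))

module AffinePlane {q} (D : Design (q * q) q 1) where
  open Incidence D
  open LinearSpace D

  1≤q : 1 ≤ q
  1≤q = ≤-trans (s≤s z≤n) (k≥2 D)

  replication≡1+q : ∀ x → replication x ≡ suc q
  replication≡1+q x = affine-replication (k≥2 D)
    (trans (replication-identity x) (cong (replication x +_) (*-identityˡ (q * q))))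

  b≡q*[1+q] : b D ≡ q * suc q
  b≡q*[1+q] = affine-blocks 1≤q (begin
    b D * q                       ≡⟨ b*k≡∑replication ⟩
    ∑[ x < q * q ] replication x  ≡⟨ sum-cong-≗ replication≡1+q ⟩
    ∑[ x < q * q ] suc q          ≡⟨ ∑-const (q * q) (suc q) ⟩
    q * q * suc q                 ∎)
    where open ≡-Reasoning

  some-block : Fin (b D)
  some-block = fromℕ< (subst (0 <_) (sym b≡q*[1+q]) (*-mono-≤ 1≤q (s≤s z≤n)))

  playfair : ∀ o x → inc o x + parallelsThrough x o ≡ 1
  playfair o x with x ∈? block D o
  ... | yes x∈o = cong₂ _+_ (χ-∈ x∈o) (parallelsThrough-on-block x∈o)
  ... | no  x∉o = trans (cong (_+ parallelsThrough x o) (χ-∉ x∉o)) (+-cancelˡ-≡ q _ _ (begin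
    q + parallelsThrough x o  ≡⟨ replication-off-block x∉o ⟨
    replication x             ≡⟨ replication≡1+q x ⟩
    suc q                     ≡⟨ +-comm 1 q ⟩
    q + 1                     ∎))
    where open ≡-Reasoning

  suc∣parallels∣≡q : ∀ o → suc ∣ parallels o ∣ ≡ q
  suc∣parallels∣≡q o = affine-parallels 1≤q (begin
    q + ∣ parallels o ∣ * q                                       ≡⟨ cong₂ _+_ (∑-inc≡k o) (cong (_* q) (sym (∣p∣≡∑χ (parallels o)))) ⟨
    ∑[ x < q * q ] inc o x + sum (χ (parallels o)) * q            ≡⟨ cong (∑[ x < q * q ] inc o x +_) (∑-weighted-blocks (χ (parallels o))) ⟨
    ∑[ x < q * q ] inc o x + ∑[ x < q * q ] parallelsThrough x o  ≡⟨ ∑-distrib-+ (inc o) (λ x → parallelsThrough x o) ⟨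
    ∑[ x < q * q ] (inc o x + parallelsThrough x o)               ≡⟨ sum-cong-≗ (playfair o) ⟩
    ∑[ x < q * q ] 1                                              ≡⟨ trans (∑-const (q * q) 1) (*-identityʳ (q * q)) ⟩
    q * q                                                         ∎)
    where open ≡-Reasoning

  parallel-class-dominating : ∀ o → Dominating D (block D o , parallels o)
  parallel-class-dominating o = covered⇒dominating
    (λ x → ≤-reflexive (sym (playfair o x)))
    (λ i → subst (λ c → 0 < c + meetCount o i) (sym (χ-tabulate (λ j → meetCount o j ≡ᵇ 0) i))
                 (𝟙[≡ᵇ0]+n-pos (meetCount o i)))

  parallel-class-size : ∀ o → ∣ block D o ∣ + ∣ parallels o ∣ ≡ 2 * q ∸ 1
  parallel-class-size o = begin
    ∣ block D o ∣ + ℓ  ≡⟨ cong (_+ ℓ) (trans (blockSize D o) (sym suc-ℓ≡q)) ⟩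
    suc ℓ + ℓ          ≡⟨ 2*suc∸1 ℓ ⟨
    2 * suc ℓ ∸ 1      ≡⟨ cong (λ n → 2 * n ∸ 1) suc-ℓ≡q ⟩
    2 * q ∸ 1          ∎
    where
    open ≡-Reasoning
    ℓ : ℕ
    ℓ = ∣ parallels o ∣
    suc-ℓ≡q : suc ℓ ≡ q
    suc-ℓ≡q = suc∣parallels∣≡q o

  dominating-size : ∀ {P L} → Dominating D (P , L) → 2 * q ∸ 1 ≤ ∣ P ∣ + ∣ L ∣
  dominating-size {P} {L} dom = dominating-size-bound {a = ∣ P ∣} {c = ∣ L ∣} 1≤q
    (dominating⇒points≤ dom)
    (subst (_≤ ∣ L ∣ + ∣ P ∣ * suc q) b≡q*[1+q] (dominating⇒blocks≤ dom replication≡1+q))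

theorem4p3 : (q : ℕ) (D : Design (q * q) q 1) → DominationNumber D (2 * q ∸ 1)
theorem4p3 q D =
  ((block D some-block , parallels some-block) ,
    parallel-class-dominating some-block , parallel-class-size some-block) ,
  λ { (P , L) dom → dominating-size dom }
  where
  open AffinePlane D
  open LinearSpace D
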